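{- Every tree that is palindromic or antipalindromic has exactly one perfect matching.
   Context: All graphs are finite, simple and undirected. For a graph $G$ on $n$ vertices with adjacency matrix $A_G$, its characteristic polynomial is $\chi_G(\lambda)=\det(\lambda I-A_G)=a_0\lambda^n+a_1\lambda^{n-1}+\dots+a_n$ (so $a_0=1$). $G$ is palindromic if $a_i=a_{n-i}$ for all $i=0,\dots,n$, and antipalindromic if $a_i=-a_{n-i}$ for all $i=0,\dots,n$. -}

module Defs where

open import Data.Nat using (ℕ; zero; suc; _∸_)
open import Data.Integer using (ℤ; 0ℤ; 1ℤ; -_) renaming (_+_ to _+ℤ_; _*_ to _*ℤ_)
open import Data.Fin using (Fin; zero; suc; toℕ; punchIn)
open import Data.Fin.Properties using (_≟_)
open import Data.Bool using (Bool; true; false; if_then_else_)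
open import Data.List using (List; []; _∷_; length; last)
open import Data.List.Relation.Unary.Unique.Propositional using (Unique)
open import Data.List.Relation.Unary.Linked using (Linked)
open import Data.Maybe using (Maybe; just)
open import Data.Product using (Σ; ∃; _×_)
open import Relation.Nullary using (¬_; does)
open import Relation.Binary.PropositionalEquality using (_≡_)
open import Data.Nat using (_≤_)

record Graph (n : ℕ) : Set where
  field
    adj   : Fin n → Fin n → Bool
    sym   : ∀ u v → adj u v ≡ adj v u
    irrefl : ∀ v → adj v v ≡ false
open Graph public

Adj : ∀ {n} → Graph n → Fin n → Fin n → Set
Adj G u v = adj G u v ≡ true

data Walk {n} (G : Graph n) : Fin n → Fin n → Set where
  here : ∀ {u} → Walk G u u
  step : ∀ {u w v} → Adj G u w → Walk G w v → Walk G u v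

Connected : ∀ {n} → Graph n → Set
Connected G = ∀ u v → Walk G u v

IsCycle : ∀ {n} → Graph n → List (Fin n) → Set
IsCycle G [] = ⊥'
  where open import Data.Empty using () renaming (⊥ to ⊥')
IsCycle G (v ∷ vs) =
  (3 ≤ length (v ∷ vs)) × Unique (v ∷ vs) × Linked (Adj G) (v ∷ vs)
  × Σ (Fin _) (λ w → (last (v ∷ vs) ≡ just w) × Adj G w v)

Acyclic : ∀ {n} → Graph n → Set
Acyclic G = ∀ cs → ¬ IsCycle G cs

IsTree : ∀ {n} → Graph n → Set
IsTree G = Connected G × Acyclic G

record IsPerfectMatching {n} (G : Graph n) (M : Fin n → Fin n → Bool) : Set where
  field
    M-sym    : ∀ u v → M u v ≡ M v u
    M-edges  : ∀ u v → M u v ≡ true → Adj G u v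
    M-unique : ∀ v → ∃ λ u → (M v u ≡ true) × (∀ w → M v w ≡ true → w ≡ u)

HasExactlyOnePerfectMatching : ∀ {n} → Graph n → Set
HasExactlyOnePerfectMatching G =
  Σ (_ → _ → Bool) λ M → IsPerfectMatching G M ×
    (∀ M′ → IsPerfectMatching G M′ → ∀ u v → M′ u v ≡ M u v)

-- Polynomials over ℤ as coefficient lists, lowest degree first.

Poly : Set
Poly = List ℤ

_⊕_ : Poly → Poly → Poly
[] ⊕ q = q
(a ∷ p) ⊕ [] = a ∷ p
(a ∷ p) ⊕ (b ∷ q) = (a +ℤ b) ∷ (p ⊕ q)

scale : ℤ → Poly → Poly
scale c [] = []
scale c (a ∷ p) = (c *ℤ a) ∷ scale c p

_⊛_ : Poly → Poly → Poly
[] ⊛ q = []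
(a ∷ p) ⊛ q = scale a q ⊕ (0ℤ ∷ (p ⊛ q))

neg : Poly → Poly
neg = scale (- 1ℤ)

pconst : ℤ → Poly
pconst c = c ∷ []

X : Poly
X = 0ℤ ∷ 1ℤ ∷ []

coeff : Poly → ℕ → ℤ
coeff [] k = 0ℤ
coeff (a ∷ p) zero = a
coeff (a ∷ p) (suc k) = coeff p k

sign : ℕ → ℤ
sign zero = 1ℤ
sign (suc zero) = - 1ℤ
sign (suc (suc k)) = sign k

sumFin : ∀ n → (Fin n → Poly) → Poly
sumFin zero f = []
sumFin (suc n) f = f zero ⊕ sumFin n (λ i → f (suc i))

det : ∀ n → (Fin n → Fin n → Poly) → Poly
det zero M = pconst 1ℤ
det (suc n) M =
  sumFin (suc n) λ j →
    scale (sign (toℕ j)) (M zero j ⊛ det n (λ i k → M (suc i) (punchIn j k)))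

A : ∀ {n} → Graph n → Fin n → Fin n → ℤ
A G u v = if adj G u v then 1ℤ else 0ℤ

charPoly : ∀ {n} → Graph n → Poly
charPoly {n} G =
  det n λ i j → (if does (i ≟ j) then X else []) ⊕ neg (pconst (A G i j))

a : ∀ {n} → Graph n → ℕ → ℤ
a {n} G i = coeff (charPoly G) (n ∸ i)

Palindromic : ∀ {n} → Graph n → Set
Palindromic {n} G = ∀ (i : Fin (suc n)) → a G (toℕ i) ≡ a G (n ∸ toℕ i)

Antipalindromic : ∀ {n} → Graph n → Set
Antipalindromic {n} G = ∀ (i : Fin (suc n)) → a G (toℕ i) ≡ - a G (n ∸ toℕ i)

{-# OPTIONS --safe #-}

-- The coefficient a₀ of χ_G is 1, so (anti)palindromicity makes a_n = ±1, and a_n is the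
-- determinant of −A_G. A nonzero determinant has a nonzero Leibniz term: an injective σ with
-- every vertex v adjacent to σ v. In a forest σ is an involution, since otherwise the orbit
-- v, σ v, σ² v, … is an infinite walk that never steps straight back, and in a finite graph
-- such a walk closes up into a cycle. So σ is a perfect matching. A second perfect matching
-- would again produce such a walk, alternating between the two matchings.

module Submission where

open import Defs hiding (sym)
open import Data.Bool using (Bool; true; false; if_then_else_)
open import Data.Empty using (⊥; ⊥-elim)
open import Data.Fin using (Fin; zero; suc; toℕ; punchIn)
open import Data.Fin.Properties
  using (_≟_; pigeonhole; punchIn-injective; punchInᵢ≢i; suc-injective; ¬∀⟶∃¬)
open import Data.Integer using (ℤ; 0ℤ; 1ℤ; -_) renaming (_+_ to _+ℤ_; _*_ to _*ℤ_)
import Data.Integer.Properties as ℤ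
open import Algebra.Properties.Monoid.Sum ℤ.+-0-monoid
  using (sum; sum-syntax; sum-cong-≗; sum-replicate-zero)
open import Data.List using ([]; _∷_; applyUpTo; last)
import Data.List.Relation.Unary.Linked.Properties as Linked
import Data.List.Relation.Unary.Unique.Propositional.Properties as Unique
open import Data.Maybe using (just)
open import Data.Nat using (ℕ; zero; suc; _+_; _<_; z≤n; s≤s)
open import Data.Nat.GeneralisedArithmetic using (fold)
open import Data.Nat.Induction using (<-rec)
import Data.Nat.Properties as ℕ
open import Data.Product using (∃; _×_; _,_; proj₁; proj₂)
open import Data.Sum using (_⊎_; inj₁; inj₂)
open import Function using (_∘_; mk⇔)
open import Function.Definitions using (Injective)
open import Relation.Binary.Definitions using (DecidableEquality)
open import Relation.Binary.PropositionalEquality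
open import Relation.Nullary using (¬_; Dec; yes; no; does; contradiction)
open import Relation.Nullary.Decidable using (dec-true; dec-false; does-⇔)

open ≡-Reasoning

coeff-⊕ : ∀ p q m → coeff (p ⊕ q) m ≡ coeff p m +ℤ coeff q m
coeff-⊕ []      q       m       = sym (ℤ.+-identityˡ _)
coeff-⊕ (c ∷ p) []      m       = sym (ℤ.+-identityʳ _)
coeff-⊕ (c ∷ p) (d ∷ q) zero    = refl
coeff-⊕ (c ∷ p) (d ∷ q) (suc m) = coeff-⊕ p q m

coeff-scale : ∀ c p m → coeff (scale c p) m ≡ c *ℤ coeff p m
coeff-scale c []      m       = sym (ℤ.*-zeroʳ c)
coeff-scale c (d ∷ p) zero    = refl
coeff-scale c (d ∷ p) (suc m) = coeff-scale c p m

coeff-∷⊛-zero : ∀ c p q → coeff ((c ∷ p) ⊛ q) 0 ≡ c *ℤ coeff q 0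
coeff-∷⊛-zero c p q = begin
  coeff ((c ∷ p) ⊛ q) 0     ≡⟨ coeff-⊕ (scale c q) (0ℤ ∷ (p ⊛ q)) 0 ⟩
  coeff (scale c q) 0 +ℤ 0ℤ ≡⟨ ℤ.+-identityʳ _ ⟩
  coeff (scale c q) 0       ≡⟨ coeff-scale c q 0 ⟩
  c *ℤ coeff q 0            ∎

coeff-∷⊛-suc : ∀ c p q m →
  coeff ((c ∷ p) ⊛ q) (suc m) ≡ c *ℤ coeff q (suc m) +ℤ coeff (p ⊛ q) m
coeff-∷⊛-suc c p q m =
  trans (coeff-⊕ (scale c q) (0ℤ ∷ (p ⊛ q)) (suc m))
        (cong (_+ℤ coeff (p ⊛ q) m) (coeff-scale c q (suc m)))

coeff-⊛-zero : ∀ p q → coeff (p ⊛ q) 0 ≡ coeff p 0 *ℤ coeff q 0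
coeff-⊛-zero []      q = refl
coeff-⊛-zero (c ∷ p) q = coeff-∷⊛-zero c p q

⊛-vanishesˡ : ∀ p q → (∀ m → coeff p m ≡ 0ℤ) → ∀ m → coeff (p ⊛ q) m ≡ 0ℤ
⊛-vanishesˡ []      q p≡0 m       = refl
⊛-vanishesˡ (c ∷ p) q p≡0 zero    =
  trans (coeff-∷⊛-zero c p q) (cong (_*ℤ coeff q 0) (p≡0 0))
⊛-vanishesˡ (c ∷ p) q p≡0 (suc m) =
  trans (coeff-∷⊛-suc c p q m)
        (cong₂ (λ x y → x *ℤ coeff q (suc m) +ℤ y) (p≡0 0) (⊛-vanishesˡ p q (p≡0 ∘ suc) m))

DegreeAtMost : ℕ → Poly → Set
DegreeAtMost k p = ∀ m → k < m → coeff p m ≡ 0ℤ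

∷-degree : ∀ {k c p} → DegreeAtMost (suc k) (c ∷ p) → DegreeAtMost k p
∷-degree deg m k<m = deg (suc m) (s≤s k<m)

∷-degree-zero : ∀ {c p} → DegreeAtMost 0 (c ∷ p) → ∀ m → coeff p m ≡ 0ℤ
∷-degree-zero deg m = deg (suc m) (s≤s z≤n)

scale-degree : ∀ {k} c p → DegreeAtMost k p → DegreeAtMost k (scale c p)
scale-degree c p deg m k<m =
  trans (coeff-scale c p m) (trans (cong (c *ℤ_) (deg m k<m)) (ℤ.*-zeroʳ c))

⊛-degree : ∀ k l p q → DegreeAtMost k p → DegreeAtMost l q → DegreeAtMost (k + l) (p ⊛ q)
⊛-degree k l []      q degp degq m       _        = refl
⊛-degree k l (c ∷ p) q degp degq (suc m) k+l<1+m = begin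
  coeff ((c ∷ p) ⊛ q) (suc m)             ≡⟨ coeff-∷⊛-suc c p q m ⟩
  c *ℤ coeff q (suc m) +ℤ coeff (p ⊛ q) m
    ≡⟨ cong₂ _+ℤ_ (cong (c *ℤ_) q-vanishes) (tail-vanishes k degp k+l<1+m) ⟩
  c *ℤ 0ℤ +ℤ 0ℤ                           ≡⟨ trans (ℤ.+-identityʳ _) (ℤ.*-zeroʳ c) ⟩
  0ℤ                                      ∎
  where
  q-vanishes : coeff q (suc m) ≡ 0ℤ
  q-vanishes = degq (suc m) (ℕ.≤-<-trans (ℕ.m≤n+m l k) k+l<1+m)
  tail-vanishes : ∀ k → DegreeAtMost k (c ∷ p) → k + l < suc m → coeff (p ⊛ q) m ≡ 0ℤ
  tail-vanishes zero    degp _            = ⊛-vanishesˡ p q (∷-degree-zero degp) m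
  tail-vanishes (suc k) degp (s≤s k+l<m) = ⊛-degree k l p q (∷-degree degp) degq m k+l<m

coeff-⊛-leading : ∀ k l p q → DegreeAtMost k p → DegreeAtMost l q →
  coeff (p ⊛ q) (k + l) ≡ coeff p k *ℤ coeff q l
coeff-⊛-leading k       l       []      q degp degq = refl
coeff-⊛-leading zero    zero    (c ∷ p) q degp degq = coeff-∷⊛-zero c p q
coeff-⊛-leading zero    (suc l) (c ∷ p) q degp degq = begin
  coeff ((c ∷ p) ⊛ q) (suc l)             ≡⟨ coeff-∷⊛-suc c p q l ⟩
  c *ℤ coeff q (suc l) +ℤ coeff (p ⊛ q) l
    ≡⟨ cong (c *ℤ coeff q (suc l) +ℤ_) (⊛-vanishesˡ p q (∷-degree-zero degp) l) ⟩
  c *ℤ coeff q (suc l) +ℤ 0ℤ              ≡⟨ ℤ.+-identityʳ _ ⟩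
  c *ℤ coeff q (suc l)                    ∎
coeff-⊛-leading (suc k) l       (c ∷ p) q degp degq = begin
  coeff ((c ∷ p) ⊛ q) (suc (k + l))                   ≡⟨ coeff-∷⊛-suc c p q (k + l) ⟩
  c *ℤ coeff q (suc (k + l)) +ℤ coeff (p ⊛ q) (k + l)
    ≡⟨ cong₂ _+ℤ_ (cong (c *ℤ_) (degq _ (s≤s (ℕ.m≤n+m l k))))
                  (coeff-⊛-leading k l p q (∷-degree degp) degq) ⟩
  c *ℤ 0ℤ +ℤ coeff p k *ℤ coeff q l                   ≡⟨ cong (_+ℤ _) (ℤ.*-zeroʳ c) ⟩
  0ℤ +ℤ coeff p k *ℤ coeff q l                        ≡⟨ ℤ.+-identityˡ _ ⟩
  coeff p k *ℤ coeff q l                              ∎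

sum-vanishes : ∀ m (f : Fin m → ℤ) → (∀ j → f j ≡ 0ℤ) → sum f ≡ 0ℤ
sum-vanishes m f f≡0 = trans (sum-cong-≗ f≡0) (sum-replicate-zero m)

sum≢0⇒∃≢0 : ∀ m (f : Fin m → ℤ) → sum f ≢ 0ℤ → ∃ λ j → f j ≢ 0ℤ
sum≢0⇒∃≢0 m f sum≢0 =
  ¬∀⟶∃¬ m (λ j → f j ≡ 0ℤ) (λ j → f j ℤ.≟ 0ℤ) (sum≢0 ∘ sum-vanishes m f)

coeff-sumFin : ∀ m f k → coeff (sumFin m f) k ≡ ∑[ j < m ] coeff (f j) k
coeff-sumFin zero    f k = refl
coeff-sumFin (suc m) f k =
  trans (coeff-⊕ (f zero) (sumFin m (f ∘ suc)) k)
        (cong (coeff (f zero) k +ℤ_) (coeff-sumFin m (f ∘ suc) k))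

sumFin-degree : ∀ {k} m f → (∀ j → DegreeAtMost k (f j)) → DegreeAtMost k (sumFin m f)
sumFin-degree m f deg i k<i =
  trans (coeff-sumFin m f i) (sum-vanishes m _ (λ j → deg j i k<i))

minor : ∀ {S : Set} {n} → Fin (suc n) → (Fin (suc n) → Fin (suc n) → S) → Fin n → Fin n → S
minor j M i k = M (suc i) (punchIn j k)

detℤ : ∀ n → (Fin n → Fin n → ℤ) → ℤ
detℤ zero    T = 1ℤ
detℤ (suc n) T = ∑[ j < suc n ] (sign (toℕ j) *ℤ (T zero j *ℤ detℤ n (minor j T)))

detℤ-identity : ∀ n (T : Fin n → Fin n → ℤ) →
  (∀ i → T i i ≡ 1ℤ) → (∀ i j → i ≢ j → T i j ≡ 0ℤ) → detℤ n T ≡ 1ℤ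
detℤ-identity zero    T diag off = refl
detℤ-identity (suc n) T diag off = cong₂ _+ℤ_ first-term other-terms
  where
  first-term : 1ℤ *ℤ (T zero zero *ℤ detℤ n (minor zero T)) ≡ 1ℤ
  first-term = cong₂ (λ x y → 1ℤ *ℤ (x *ℤ y)) (diag zero)
    (detℤ-identity n (minor zero T) (diag ∘ suc) (λ i j i≢j → off (suc i) (suc j) (i≢j ∘ suc-injective)))
  other-terms : ∑[ j < n ] (sign (toℕ (suc j)) *ℤ (T zero (suc j) *ℤ detℤ n (minor (suc j) T))) ≡ 0ℤ
  other-terms = sum-vanishes n _ λ j →
    trans (cong (λ x → sign (toℕ (suc j)) *ℤ (x *ℤ detℤ n (minor (suc j) T))) (off zero (suc j) λ ()))
          (ℤ.*-zeroʳ (sign (toℕ (suc j))))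

laplaceTerm : ∀ n → (Fin (suc n) → Fin (suc n) → Poly) → Fin (suc n) → Poly
laplaceTerm n M j = scale (sign (toℕ j)) (M zero j ⊛ det n (minor j M))

coeff-det-suc : ∀ n M k → coeff (det (suc n) M) k ≡
  ∑[ j < suc n ] (sign (toℕ j) *ℤ coeff (M zero j ⊛ det n (minor j M)) k)
coeff-det-suc n M k = trans (coeff-sumFin (suc n) (laplaceTerm n M) k)
  (sum-cong-≗ λ j → coeff-scale (sign (toℕ j)) (M zero j ⊛ det n (minor j M)) k)

Linear : ∀ {n} → (Fin n → Fin n → Poly) → Set
Linear M = ∀ i j → DegreeAtMost 1 (M i j)

minor-linear : ∀ {n} (M : Fin (suc n) → Fin (suc n) → Poly) j → Linear M → Linear (minor j M)
minor-linear M j lin i k = lin (suc i) (punchIn j k)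

det-degree : ∀ n M → Linear M → DegreeAtMost n (det n M)
det-degree zero    M lin (suc m) _ = refl
det-degree (suc n) M lin = sumFin-degree (suc n) (laplaceTerm n M) λ j →
  scale-degree (sign (toℕ j)) (M zero j ⊛ det n (minor j M))
    (⊛-degree 1 n (M zero j) _ (lin zero j) (det-degree n (minor j M) (minor-linear M j lin)))

coeff-det-leading : ∀ n M → Linear M → coeff (det n M) n ≡ detℤ n (λ i j → coeff (M i j) 1)
coeff-det-leading zero    M lin = refl
coeff-det-leading (suc n) M lin =
  trans (coeff-det-suc n M (suc n)) (sum-cong-≗ λ j → cong (sign (toℕ j) *ℤ_) (leading-term j))
  where
  leading-term : ∀ j → coeff (M zero j ⊛ det n (minor j M)) (1 + n) ≡
                       coeff (M zero j) 1 *ℤ detℤ n (λ i k → coeff (minor j M i k) 1)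
  leading-term j = begin
    coeff (M zero j ⊛ det n (minor j M)) (1 + n)
      ≡⟨ coeff-⊛-leading 1 n (M zero j) _ (lin zero j) (det-degree n (minor j M) (minor-linear M j lin)) ⟩
    coeff (M zero j) 1 *ℤ coeff (det n (minor j M)) n
      ≡⟨ cong (coeff (M zero j) 1 *ℤ_) (coeff-det-leading n (minor j M) (minor-linear M j lin)) ⟩
    coeff (M zero j) 1 *ℤ detℤ n (λ i k → coeff (minor j M i k) 1)
      ∎

record Transversal (n : ℕ) (P : Fin n → Fin n → Set) : Set where
  field
    σ         : Fin n → Fin n
    injective : Injective _≡_ _≡_ σ
    supported : ∀ i → P i (σ i)

extendTransversal : ∀ {n P} (j : Fin (suc n)) → P zero j →
  Transversal n (λ i k → P (suc i) (punchIn j k)) → Transversal (suc n) P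
extendTransversal {n} {P} j Pj τ = record { σ = σ′ ; injective = injective′ ; supported = supported′ }
  where
  open Transversal τ
  σ′ : Fin (suc n) → Fin (suc n)
  σ′ zero    = j
  σ′ (suc i) = punchIn j (σ i)
  injective′ : Injective _≡_ _≡_ σ′
  injective′ {zero}  {zero}  _ = refl
  injective′ {zero}  {suc y} e = contradiction (sym e) (punchInᵢ≢i j (σ y))
  injective′ {suc x} {zero}  e = contradiction e (punchInᵢ≢i j (σ x))
  injective′ {suc x} {suc y} e = cong suc (injective (punchIn-injective j _ _ e))
  supported′ : ∀ i → P i (σ′ i)
  supported′ zero    = Pj
  supported′ (suc i) = supported i

det-coeff₀≢0⇒transversal : ∀ n M → coeff (det n M) 0 ≢ 0ℤ →
  Transversal n (λ i j → coeff (M i j) 0 ≢ 0ℤ)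
det-coeff₀≢0⇒transversal zero M _ =
  record { σ = λ () ; injective = λ { {()} } ; supported = λ () }
det-coeff₀≢0⇒transversal (suc n) M det₀≢0
  with j , term≢0 ← sum≢0⇒∃≢0 (suc n) _ (det₀≢0 ∘ trans (coeff-det-suc n M 0)) =
  extendTransversal j (λ e → product≢0 (cong (_*ℤ minor₀) e))
    (det-coeff₀≢0⇒transversal n (minor j M) λ e →
      product≢0 (trans (cong (entry₀ *ℤ_) e) (ℤ.*-zeroʳ entry₀)))
  where
  entry₀ minor₀ : ℤ
  entry₀ = coeff (M zero j) 0
  minor₀ = coeff (det n (minor j M)) 0
  product≢0 : entry₀ *ℤ minor₀ ≢ 0ℤ
  product≢0 e = term≢0 (begin
    sign (toℕ j) *ℤ coeff (M zero j ⊛ det n (minor j M)) 0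
      ≡⟨ cong (sign (toℕ j) *ℤ_) (trans (coeff-⊛-zero (M zero j) _) e) ⟩
    sign (toℕ j) *ℤ 0ℤ
      ≡⟨ ℤ.*-zeroʳ (sign (toℕ j)) ⟩
    0ℤ ∎)

1≢0 : 1ℤ ≢ 0ℤ
1≢0 ()

-- charPoly G is, definitionally, det n (charMatrix G).

charMatrix : ∀ {n} → Graph n → Fin n → Fin n → Poly
charMatrix G i j = (if does (i ≟ j) then X else []) ⊕ neg (pconst (A G i j))

module _ {n} (G : Graph n) where

  charMatrix-linear : Linear (charMatrix G)
  charMatrix-linear i j (suc zero)    (s≤s ())
  charMatrix-linear i j (suc (suc m)) _ with does (i ≟ j)
  ... | true  = refl
  ... | false = refl

  charMatrix-coeff₁-diagonal : ∀ i → coeff (charMatrix G i i) 1 ≡ 1ℤ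
  charMatrix-coeff₁-diagonal i rewrite dec-true (i ≟ i) refl = refl

  charMatrix-coeff₁-offDiagonal : ∀ i j → i ≢ j → coeff (charMatrix G i j) 1 ≡ 0ℤ
  charMatrix-coeff₁-offDiagonal i j i≢j rewrite dec-false (i ≟ j) i≢j = refl

  charMatrix-coeff₀≢0⇒adjacent : ∀ i j → coeff (charMatrix G i j) 0 ≢ 0ℤ → Adj G i j
  charMatrix-coeff₀≢0⇒adjacent i j c≢0 with adj G i j
  ... | true  = refl
  ... | false with does (i ≟ j)
  ...   | true  = contradiction refl c≢0
  ...   | false = contradiction refl c≢0

  charPoly-monic : coeff (charPoly G) n ≡ 1ℤ
  charPoly-monic = trans (coeff-det-leading n (charMatrix G) charMatrix-linear)
    (detℤ-identity n _ charMatrix-coeff₁-diagonal charMatrix-coeff₁-offDiagonal)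

  aₙ≡coeff₀ : a G n ≡ coeff (charPoly G) 0
  aₙ≡coeff₀ = cong (coeff (charPoly G)) (ℕ.n∸n≡0 n)

  palindromic⊎antipalindromic⇒coeff₀≢0 :
    Palindromic G ⊎ Antipalindromic G → coeff (charPoly G) 0 ≢ 0ℤ
  palindromic⊎antipalindromic⇒coeff₀≢0 (inj₁ palindromic) χ₀≡0 = 1≢0 (begin
    1ℤ                     ≡⟨ sym charPoly-monic ⟩
    a G 0                  ≡⟨ palindromic zero ⟩
    a G n                  ≡⟨ aₙ≡coeff₀ ⟩
    coeff (charPoly G) 0   ≡⟨ χ₀≡0 ⟩
    0ℤ                     ∎)
  palindromic⊎antipalindromic⇒coeff₀≢0 (inj₂ antipalindromic) χ₀≡0 = 1≢0 (begin
    1ℤ                     ≡⟨ sym charPoly-monic ⟩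
    a G 0                  ≡⟨ antipalindromic zero ⟩
    - a G n                ≡⟨ cong -_ (trans aₙ≡coeff₀ χ₀≡0) ⟩
    0ℤ                     ∎)

DistinctBelow : {S : Set} → (ℕ → S) → ℕ → Set
DistinctBelow f b = ∀ {i j} → i < j → j < b → f i ≢ f j

module _ {S : Set} (_≟ₛ_ : DecidableEquality S) (f : ℕ → S) where

  RepeatAt : ℕ → Set
  RepeatAt j = ∃ λ i → i < j × f i ≡ f j

  earliestRepeat : ∀ j → RepeatAt j → ∃ λ j → RepeatAt j × DistinctBelow f j
  earliestRepeat = <-rec _ search
    where
    search : ∀ j → (∀ {k} → k < j → RepeatAt k → ∃ λ j → RepeatAt j × DistinctBelow f j) →
             RepeatAt j → ∃ λ j → RepeatAt j × DistinctBelow f j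
    search j earlier repeatⱼ with ℕ.anyUpTo? (λ k → ℕ.anyUpTo? (λ i → f i ≟ₛ f k) k) j
    ... | yes (k , k<j , repeatₖ) = earlier k<j repeatₖ
    ... | no  none = j , repeatⱼ , λ i<k k<j fᵢ≡fₖ → none (_ , k<j , _ , i<k , fᵢ≡fₖ)

record NonBacktrackingRay {n} (G : Graph n) : Set where
  field
    vertex          : ℕ → Fin n
    adjacent        : ∀ t → Adj G (vertex t) (vertex (suc t))
    nonBacktracking : ∀ t → vertex (suc (suc t)) ≢ vertex t

module _ {n} {G : Graph n} where

  open NonBacktrackingRay

  dropRay : ℕ → NonBacktrackingRay G → NonBacktrackingRay G
  dropRay s r = record
    { vertex          = λ t → vertex r (t + s)
    ; adjacent        = λ t → adjacent r (t + s)
    ; nonBacktracking = λ t → nonBacktracking r (t + s)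
    }

  last-applyUpTo : ∀ (g : ℕ → Fin n) k → last (applyUpTo g (suc k)) ≡ just (g k)
  last-applyUpTo g zero          = refl
  last-applyUpTo g (suc zero)    = refl
  last-applyUpTo g (suc (suc k)) = last-applyUpTo (g ∘ suc) (suc k)

  closedWalk⇒cycle : ∀ (g : ℕ → Fin n) → (∀ t → Adj G (g t) (g (suc t))) → ∀ k →
    g (3 + k) ≡ g 0 → DistinctBelow g (3 + k) → IsCycle G (applyUpTo g (3 + k))
  closedWalk⇒cycle g adjacentᵍ k closed distinct =
    s≤s (s≤s (s≤s z≤n)) ,
    Unique.applyUpTo⁺₁ g (3 + k) distinct ,
    Linked.applyUpTo⁺₂ g (3 + k) adjacentᵍ ,
    g (2 + k) , last-applyUpTo g (2 + k) , subst (Adj G (g (2 + k))) closed (adjacentᵍ (2 + k))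

  module _ (acyclic : Acyclic G) where

    ¬closedRay : ∀ (r : NonBacktrackingRay G) k →
      vertex r (suc k) ≡ vertex r 0 → DistinctBelow (vertex r) (suc k) → ⊥
    ¬closedRay r zero closed _
      with () ← trans (sym (subst (Adj G (vertex r 0)) closed (adjacent r 0))) (irrefl G (vertex r 0))
    ¬closedRay r (suc zero) closed _ = nonBacktracking r 0 closed
    ¬closedRay r (suc (suc k)) closed distinct =
      acyclic _ (closedWalk⇒cycle (vertex r) (adjacent r) k closed distinct)

    -- By pigeonhole some vertex repeats; from the first occurrence of the earliest repeat
    -- on, the ray is a closed walk with no other repetition.
    acyclic⇒¬nonBacktrackingRay : ¬ NonBacktrackingRay G
    acyclic⇒¬nonBacktrackingRay r
      with i , j , i<j , vᵢ≡vⱼ ← pigeonhole (ℕ.n<1+n n) (vertex r ∘ toℕ)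
      with e , (s , s<e , vₛ≡vₑ) , distinct ← earliestRepeat _≟_ (vertex r) (toℕ j) (toℕ i , i<j , vᵢ≡vⱼ)
      with k , refl ← ℕ.m≤n⇒∃[o]m+o≡n s<e
      = ¬closedRay (dropRay s r) k (sym closed) distinct′
      where
      closed : vertex r s ≡ vertex r (suc k + s)
      closed = trans vₛ≡vₑ (cong (vertex r ∘ suc) (ℕ.+-comm s k))
      distinct′ : DistinctBelow (λ t → vertex r (t + s)) (suc k)
      distinct′ {t} {u} t<u u<1+k = distinct (ℕ.+-monoˡ-< s t<u)
        (subst (u + s <_) (cong suc (ℕ.+-comm k s)) (ℕ.+-monoˡ-< s u<1+k))

does≡true⇒ : ∀ {P : Set} (d : Dec P) → does d ≡ true → P
does≡true⇒ (yes p) _ = p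

record MatchingInvolution {n} (G : Graph n) : Set where
  field
    partner            : Fin n → Fin n
    partner-adjacent   : ∀ v → Adj G v (partner v)
    partner-involutive : ∀ v → partner (partner v) ≡ v

module _ {n} {G : Graph n} where

  open MatchingInvolution

  matchingOf : MatchingInvolution G → Fin n → Fin n → Bool
  matchingOf ι u v = does (partner ι u ≟ v)

  partner-≡-sym : ∀ (ι : MatchingInvolution G) {u v} → partner ι u ≡ v → partner ι v ≡ u
  partner-≡-sym ι {u} refl = partner-involutive ι u

  matchingOf-isPerfectMatching : ∀ ι → IsPerfectMatching G (matchingOf ι)
  matchingOf-isPerfectMatching ι = record
    { M-sym    = λ u v →
        does-⇔ (mk⇔ (partner-≡-sym ι) (partner-≡-sym ι)) (partner ι u ≟ v) (partner ι v ≟ u)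
    ; M-edges  = λ u v uv∈M → subst (Adj G u) (does≡true⇒ (partner ι u ≟ v) uv∈M) (partner-adjacent ι u)
    ; M-unique = λ v → partner ι v , dec-true (partner ι v ≟ partner ι v) refl ,
                       λ w vw∈M → sym (does≡true⇒ (partner ι v ≟ w) vw∈M)
    }

  module _ {M} (isPM : IsPerfectMatching G M) where

    open IsPerfectMatching isPM

    partnerIn : Fin n → Fin n
    partnerIn v = proj₁ (M-unique v)

    partnerIn-matched : ∀ v → M v (partnerIn v) ≡ true
    partnerIn-matched v = proj₁ (proj₂ (M-unique v))

    partnerIn-unique : ∀ v w → M v w ≡ true → w ≡ partnerIn v
    partnerIn-unique v = proj₂ (proj₂ (M-unique v))

    toMatchingInvolution : MatchingInvolution G
    toMatchingInvolution = record
      { partner            = partnerIn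
      ; partner-adjacent   = λ v → M-edges v _ (partnerIn-matched v)
      ; partner-involutive = λ v →
          sym (partnerIn-unique (partnerIn v) v (trans (M-sym _ v) (partnerIn-matched v)))
      }

    matchingOf-toMatchingInvolution : ∀ u v → M u v ≡ matchingOf toMatchingInvolution u v
    matchingOf-toMatchingInvolution u v with M u v in uv∈M
    ... | true  = sym (dec-true (partnerIn u ≟ v) (sym (partnerIn-unique u v uv∈M)))
    ... | false = sym (dec-false (partnerIn u ≟ v) λ { refl →
                    contradiction (trans (sym uv∈M) (partnerIn-matched u)) λ () })

  alternate : (Fin n → Fin n) → (Fin n → Fin n) → Fin n → ℕ → Fin n
  alternate f g x zero    = x
  alternate f g x (suc t) = alternate g f (f x) t

  alternate-adjacent : ∀ (ι κ : MatchingInvolution G) x t →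
    Adj G (alternate (partner ι) (partner κ) x t) (alternate (partner ι) (partner κ) x (suc t))
  alternate-adjacent ι κ x zero    = partner-adjacent ι x
  alternate-adjacent ι κ x (suc t) = alternate-adjacent κ ι (partner ι x) t

  -- κ and ι again disagree at ι x, whose ι-partner is x.
  disagreement-persists : ∀ (ι κ : MatchingInvolution G) x →
    partner ι x ≢ partner κ x → partner κ (partner ι x) ≢ x
  disagreement-persists ι κ x ιx≢κx κιx≡x =
    ιx≢κx (trans (sym (partner-involutive κ (partner ι x))) (cong (partner κ) κιx≡x))

  alternate-nonBacktracking : ∀ (ι κ : MatchingInvolution G) x → partner ι x ≢ partner κ x →
    ∀ t → alternate (partner ι) (partner κ) x (2 + t) ≢ alternate (partner ι) (partner κ) x t
  alternate-nonBacktracking ι κ x ιx≢κx zero = disagreement-persists ι κ x ιx≢κx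
  alternate-nonBacktracking ι κ x ιx≢κx (suc t) =
    alternate-nonBacktracking κ ι (partner ι x)
      (λ e → disagreement-persists ι κ x ιx≢κx (trans e (partner-involutive ι x))) t

  alternatingRay : ∀ (ι κ : MatchingInvolution G) x → partner ι x ≢ partner κ x →
    NonBacktrackingRay G
  alternatingRay ι κ x ιx≢κx = record
    { vertex          = alternate (partner ι) (partner κ) x
    ; adjacent        = alternate-adjacent ι κ x
    ; nonBacktracking = alternate-nonBacktracking ι κ x ιx≢κx
    }

  module _ (acyclic : Acyclic G) where

    acyclic⇒partner-unique : ∀ (ι κ : MatchingInvolution G) x → partner ι x ≡ partner κ x
    acyclic⇒partner-unique ι κ x with partner ι x ≟ partner κ x
    ... | yes ιx≡κx = ιx≡κx
    ... | no  ιx≢κx = ⊥-elim (acyclic⇒¬nonBacktrackingRay acyclic (alternatingRay ι κ x ιx≢κx))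

    acyclic⇒perfectMatching-unique : ∀ {M M′} → IsPerfectMatching G M → IsPerfectMatching G M′ →
      ∀ u v → M u v ≡ M′ u v
    acyclic⇒perfectMatching-unique {M} {M′} isPM isPM′ u v = begin
      M u v                   ≡⟨ matchingOf-toMatchingInvolution isPM u v ⟩
      does (partner ι u ≟ v)  ≡⟨ cong (λ w → does (w ≟ v)) (acyclic⇒partner-unique ι ι′ u) ⟩
      does (partner ι′ u ≟ v) ≡⟨ sym (matchingOf-toMatchingInvolution isPM′ u v) ⟩
      M′ u v                  ∎
      where
      ι ι′ : MatchingInvolution G
      ι  = toMatchingInvolution isPM
      ι′ = toMatchingInvolution isPM′

    module _ (σ : Fin n → Fin n) (σ-injective : Injective _≡_ _≡_ σ)
             (σ-adjacent : ∀ v → Adj G v (σ v)) where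

      orbit-nonBacktracking : ∀ x → σ (σ x) ≢ x → ∀ t → fold x σ (2 + t) ≢ fold x σ t
      orbit-nonBacktracking x σσx≢x zero    = σσx≢x
      orbit-nonBacktracking x σσx≢x (suc t) = orbit-nonBacktracking x σσx≢x t ∘ σ-injective

      acyclic⇒injective-involutive : ∀ x → σ (σ x) ≡ x
      acyclic⇒injective-involutive x with σ (σ x) ≟ x
      ... | yes σσx≡x = σσx≡x
      ... | no  σσx≢x = ⊥-elim (acyclic⇒¬nonBacktrackingRay acyclic record
        { vertex          = fold x σ
        ; adjacent        = σ-adjacent ∘ fold x σ
        ; nonBacktracking = orbit-nonBacktracking x σσx≢x
        })

    charPoly-coeff₀≢0⇒matchingInvolution : coeff (charPoly G) 0 ≢ 0ℤ → MatchingInvolution G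
    charPoly-coeff₀≢0⇒matchingInvolution χ₀≢0 = record
      { partner            = σ
      ; partner-adjacent   = σ-adjacent
      ; partner-involutive = acyclic⇒injective-involutive σ injective σ-adjacent
      }
      where
      open Transversal (det-coeff₀≢0⇒transversal n (charMatrix G) χ₀≢0)
      σ-adjacent : ∀ v → Adj G v (σ v)
      σ-adjacent v = charMatrix-coeff₀≢0⇒adjacent G v (σ v) (supported v)

proposition1 : ∀ (n : ℕ) (G : Graph n) → IsTree G →
    Palindromic G ⊎ Antipalindromic G → HasExactlyOnePerfectMatching G
proposition1 n G (_ , acyclic) symmetric =
  matchingOf ι , matchingOf-isPerfectMatching ι ,
  λ _ isPM′ → acyclic⇒perfectMatching-unique acyclic isPM′ (matchingOf-isPerfectMatching ι)
  where
  ι : MatchingInvolution G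
  ι = charPoly-coeff₀≢0⇒matchingInvolution acyclic (palindromic⊎antipalindromic⇒coeff₀≢0 G symmetric)
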